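{- Let $n$ be a positive integer with $n\equiv1\pmod4$. Then \[ \sum_{d\mid n}\left(\frac{ -1}{d}\right)d^2+6\sum_{d\mid\frac n3}\left(\frac{ -1}{d}\right)d^2>0, \] where the second sum is empty (equal to $0$) if $3\nmid n$. In particular, if $A(n)$ denotes the $n$-th Fourier coefficient of $\mathcal E$, then for every integer $n\ge0$, \[ \operatorname{sgn}(A(4n+1))=\begin{cases}1&\text{if }3\mid n,\\-1&\text{otherwise}.\end{cases} \]
   Context: $\left(\frac{ -1}{d}\right)$ is the Kronecker symbol (for odd $d$ it equals $(-1)^{(d-1)/2}$). The series $\mathcal E(z)=\sum_{n}A(n)q^n$ is defined by \[ \mathcal E(z):=\sum_{\substack{n\ge1\\ n\equiv1\ (12)}}\sum_{d\mid n}\left(\tfrac{ -1}{d}\right)d^2q^n-\frac12\sum_{\substack{n\ge1\\ n\equiv5\ (12)}}\sum_{d\mid n}\left(\tfrac{ -1}{d}\right)d^2q^n-2\sum_{\substack{n\ge1\\ n\equiv9\ (12)}}\Big(\sum_{d\mid n}\left(\tfrac{ -1}{d}\right)d^2+6\sum_{d\mid \frac n3}\left(\tfrac{ -1}{d}\right)d^2\Big)q^n . \] -}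

module Defs where

open import Data.Nat using (ℕ; zero; suc; _%_; _/_; _≡ᵇ_)
open import Data.Nat.Divisibility using (_∣_; _∣?_)
open import Data.Integer as ℤ using (ℤ; +_; -[1+_]; +[1+_])
open import Data.Rational as ℚ using (ℚ; ↥_)
open import Data.List using (List; upTo; map; filter)
open import Data.Bool using (if_then_else_)
open import Relation.Nullary using (yes; no)

-- Kronecker symbol (-1/d): 0 for even d, (-1)^((d-1)/2) for odd d.
kron-1 : ℕ → ℤ
kron-1 d with d % 4
... | 1 = + 1
... | 3 = -[1+ 0 ]
... | _ = + 0

-- divisors of m (the positive d with d ∣ m); empty for m = 0.
divisors : ℕ → List ℕ
divisors m = filter (λ d → d ∣? m) (map suc (upTo m))

sumℤ : List ℤ → ℤ
sumℤ Data.List.[] = + 0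
sumℤ (x Data.List.∷ xs) = x ℤ.+ sumℤ xs

σχ : ℕ → ℤ
σχ m = sumℤ (map (λ d → kron-1 d ℤ.* (+ d) ℤ.* (+ d)) (divisors m))

σχ3 : ℕ → ℤ
σχ3 n with 3 ∣? n
... | yes _ = σχ (n / 3)
... | no _  = + 0

B : ℕ → ℤ
B n = σχ n ℤ.+ (+ 6) ℤ.* σχ3 n

toℚ : ℤ → ℚ
toℚ z = z ℚ./ 1

A : ℕ → ℚ
A n with n % 12
... | 1 = toℚ (σχ n)
... | 5 = ℚ.- (ℚ.½ ℚ.* toℚ (σχ n))
... | 9 = ℚ.- (toℚ (+ 2) ℚ.* toℚ (σχ n ℤ.+ (+ 6) ℤ.* σχ (n / 3)))
... | _ = ℚ.0ℚ

sgn : ℚ → ℤ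
sgn q with ↥ q
... | +[1+ _ ] = + 1
... | + 0 = + 0
... | -[1+ _ ] = -[1+ 0 ]

-- Reindexing d ↦ n/d and using (-1/(n/d)) = (-1/n)(-1/d) for odd n gives
-- σχ(n) = (-1/n) Σ_{d ∣ n} (-1/d) (n/d)². The term d = 1 contributes n², and
-- since 1/d² ≤ 1/(2(d-1)) - 1/(2(d+1)), the odd d > b contribute at most
-- n²/(2b) in absolute value. So σχ(n) ≥ n²/2 > 0 when n ≡ 1 (mod 4). If moreover
-- n = 3q, then q ≡ 3 (mod 4) and σχ(q) = -Σ_{d ∣ q} (-1/d)(q/d)² ≥ -q² - q²/8, as
-- the term d = 3 has the favourable sign, while σχ(n) ≥ 9q² - q² - 9q²/8; hence
-- σχ(n) + 6σχ(q) ≥ q²/8 > 0. The signs of A(4k+1) follow, since 4k+1 ≡ 1, 5, 9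
-- (mod 12) according as k ≡ 0, 1, 2 (mod 3).

module Submission where

open import Defs
open import Data.Nat as ℕ
  using (ℕ; zero; suc; _%_; _/_; _*_; _+_; _≥_; _≤_; _<_; z≤n; s≤s; z<s; NonZero)
open import Data.Nat.Properties
open import Data.Nat.DivMod
open import Data.Nat.Divisibility
  using (_∣_; _∣?_; divides; 1∣_; 0∣⇒≡0; m∣m*n; ∣⇒≤; m%n≡0⇒n∣m; n∣m⇒m%n≡0)
import Data.Nat.Tactic.RingSolver as ℕ-Solver
open import Data.Integer as ℤ using (ℤ; +_; -[1+_]; +[1+_]; ∣_∣)
import Data.Integer.Properties as ℤP
import Data.Integer.Tactic.RingSolver as ℤ-Solver
open import Data.Rational as ℚ using (mkℚ)
import Data.Rational.Properties as ℚP
open import Data.List using (List; []; _∷_; map; filter; foldr; upTo)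
open import Data.Nat.ListAction using (sum)
open import Data.List.Properties using (map-∘; map-applyUpTo; filter-accept)
open import Data.List.Membership.Propositional using (_∈_)
open import Data.List.Membership.Propositional.Properties
  using (∈-filter⁻; ∈-filter⁺; ∈-map⁻; ∈-map⁺; ∈-upTo⁺)
open import Data.List.Membership.Propositional.Properties.WithK using (unique∧set⇒bag)
open import Data.List.Relation.Unary.Any using (here; there)
open import Data.List.Relation.Unary.All as All using (All; []; _∷_)
open import Data.List.Relation.Unary.Unique.Propositional using (Unique)
import Data.List.Relation.Unary.Unique.Propositional.Properties as Unique
import Data.List.Relation.Unary.All.Properties as AllP
import Data.List.Relation.Unary.AllPairs as AllPairs
open import Data.List.Relation.Binary.BagAndSetEquality using (∼bag⇒↭)
open import Data.List.Relation.Binary.Permutation.Propositional using (_↭_; ↭⇒↭ₛ)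
import Data.List.Relation.Binary.Permutation.Propositional.Properties as ↭
import Data.List.Relation.Binary.Permutation.Setoid.Properties as ↭ₛ
open import Data.Bool using (true; false)
open import Data.Empty using (⊥-elim)
open import Data.Product using (_×_; _,_; proj₂)
open import Data.Sum using (_⊎_; inj₁; inj₂)
open import Function using (id; _∘_)
open import Function.Bundles using (mk⇔)
open import Relation.Binary.PropositionalEquality
open import Relation.Nullary using (¬_; yes; no; does; contradiction)
open import Relation.Nullary.Decidable using (from-yes; _⊎-dec_)
open import Relation.Unary using (Pred; Decidable)
open import Level using (0ℓ)

sumℤ≡foldr : ∀ xs → sumℤ xs ≡ foldr ℤ._+_ (+ 0) xs
sumℤ≡foldr [] = refl
sumℤ≡foldr (x ∷ xs) = cong (λ s → x ℤ.+ s) (sumℤ≡foldr xs)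

sumℤ-↭ : ∀ {xs ys} → xs ↭ ys → sumℤ xs ≡ sumℤ ys
sumℤ-↭ {xs} {ys} p = begin
  sumℤ xs                  ≡⟨ sumℤ≡foldr xs ⟩
  foldr ℤ._+_ (+ 0) xs     ≡⟨ ↭ₛ.foldr-commMonoid (setoid ℤ) ℤP.+-0-isCommutativeMonoid (↭⇒↭ₛ p) ⟩
  foldr ℤ._+_ (+ 0) ys     ≡⟨ sumℤ≡foldr ys ⟨
  sumℤ ys                  ∎
  where open ≡-Reasoning

sumℤ-map-cong : ∀ {f g : ℕ → ℤ} xs → (∀ {x} → x ∈ xs → f x ≡ g x) → sumℤ (map f xs) ≡ sumℤ (map g xs)
sumℤ-map-cong [] _ = refl
sumℤ-map-cong (x ∷ xs) f≡g = cong₂ ℤ._+_ (f≡g (here refl)) (sumℤ-map-cong xs (f≡g ∘ there))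

sumℤ-map-*ˡ : ∀ c (f : ℕ → ℤ) xs → sumℤ (map (λ x → c ℤ.* f x) xs) ≡ c ℤ.* sumℤ (map f xs)
sumℤ-map-*ˡ c f [] = sym (ℤP.*-zeroʳ c)
sumℤ-map-*ˡ c f (x ∷ xs) =
  trans (cong (λ s → c ℤ.* f x ℤ.+ s) (sumℤ-map-*ˡ c f xs)) (sym (ℤP.*-distribˡ-+ c (f x) _))

module _ {P : Pred ℕ 0ℓ} (P? : Decidable P) (f : ℕ → ℤ) where

  ∣sumℤ-filter∣≤ : ∀ xs → ∣ sumℤ (map f (filter P? xs)) ∣ ≤ sum (map (λ x → ∣ f x ∣) xs)
  ∣sumℤ-filter∣≤ [] = z≤n
  ∣sumℤ-filter∣≤ (x ∷ xs) with does (P? x)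
  ... | true  = ≤-trans (ℤP.∣i+j∣≤∣i∣+∣j∣ (f x) _) (+-monoʳ-≤ ∣ f x ∣ (∣sumℤ-filter∣≤ xs))
  ... | false = ≤-trans (∣sumℤ-filter∣≤ xs) (m≤n+m _ ∣ f x ∣)

  sumℤ-filter-drop : ∀ {x} xs → f x ℤ.≤ + 0 →
                     sumℤ (map f (filter P? (x ∷ xs))) ℤ.≤ sumℤ (map f (filter P? xs))
  sumℤ-filter-drop {x} xs fx≤0 with does (P? x)
  ... | true  = ℤP.≤-trans (ℤP.+-monoˡ-≤ _ fx≤0) (ℤP.≤-reflexive (ℤP.+-identityˡ _))
  ... | false = ℤP.≤-refl

∣i∣≤n⇒0≤i+n : ∀ i {n} → ∣ i ∣ ≤ n → + 0 ℤ.≤ i ℤ.+ + n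
∣i∣≤n⇒0≤i+n (+ m) _ = ℤ.+≤+ z≤n
∣i∣≤n⇒0≤i+n -[1+ m ] m<n = subst (+ 0 ℤ.≤_) (sym (ℤP.⊖-≥ m<n)) (ℤ.+≤+ z≤n)

∣i∣≤n⇒i≤n : ∀ i {n} → ∣ i ∣ ≤ n → i ℤ.≤ + n
∣i∣≤n⇒i≤n (+ m) m≤n = ℤ.+≤+ m≤n
∣i∣≤n⇒i≤n -[1+ m ] _ = ℤ.-≤+

a≤i+b∧b<a⇒0<i : ∀ {a b} i → + a ℤ.≤ i ℤ.+ + b → b < a → + 0 ℤ.< i
a≤i+b∧b<a⇒0<i +[1+ _ ] _ _ = ℤ.+<+ z<s
a≤i+b∧b<a⇒0<i (+ 0) (ℤ.+≤+ a≤b) b<a = ⊥-elim (<⇒≱ b<a a≤b)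
a≤i+b∧b<a⇒0<i {b = b} -[1+ m ] a≤i+b b<a =
  ⊥-elim (<⇒≱ b<a (ℤP.drop‿+≤+ (ℤP.≤-trans a≤i+b (ℤP.m⊖n≤m b (suc m)))))

2*m≤n⇒m<n : ∀ {m n} → 2 * m ≤ n → 0 < n → m < n
2*m≤n⇒m<n {zero} _ 0<n = 0<n
2*m≤n⇒m<n {suc m} 2m≤n _ = <-≤-trans (m<m+n (suc m) z<s) 2m≤n

-- Divisors and the involution d ↦ n / d

range : ℕ → ℕ → List ℕ
range a zero = []
range a (suc k) = a ∷ range (suc a) k

map-suc-range : ∀ a k → map suc (range a k) ≡ range (suc a) k
map-suc-range a zero = refl
map-suc-range a (suc k) = cong (suc a ∷_) (map-suc-range (suc a) k)

upTo≡range : ∀ n → upTo n ≡ range 0 n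
upTo≡range zero = refl
upTo≡range (suc n) = cong (0 ∷_) (begin
  Data.List.applyUpTo suc n   ≡⟨ map-applyUpTo id suc n ⟨
  map suc (upTo n)            ≡⟨ cong (map suc) (upTo≡range n) ⟩
  map suc (range 0 n)         ≡⟨ map-suc-range 0 n ⟩
  range 1 n                   ∎)
  where open ≡-Reasoning

divisors-suc : ∀ k → divisors (suc k) ≡ 1 ∷ filter (_∣? suc k) (range 2 k)
divisors-suc k = begin
  filter (_∣? suc k) (map suc (upTo (suc k)))     ≡⟨ cong (filter (_∣? suc k) ∘ map suc) (upTo≡range (suc k)) ⟩
  filter (_∣? suc k) (map suc (range 0 (suc k)))  ≡⟨ cong (filter (_∣? suc k)) (map-suc-range 0 (suc k)) ⟩
  filter (_∣? suc k) (1 ∷ range 2 k)              ≡⟨ filter-accept (_∣? suc k) (1∣ suc k) ⟩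
  1 ∷ filter (_∣? suc k) (range 2 k)              ∎
  where open ≡-Reasoning

∈-divisors⁻ : ∀ {n d} → d ∈ divisors n → d ∣ n
∈-divisors⁻ {n} = proj₂ ∘ ∈-filter⁻ (_∣? n) {xs = map suc (upTo n)}

∈-divisors⁺ : ∀ {n d} → .{{NonZero n}} → d ∣ n → d ∈ divisors n
∈-divisors⁺ {n} {zero} d∣n = ⊥-elim (ℕ.≢-nonZero⁻¹ n (0∣⇒≡0 d∣n))
∈-divisors⁺ {n} {suc d} d∣n = ∈-filter⁺ (_∣? n) (∈-map⁺ suc (∈-upTo⁺ (∣⇒≤ d∣n))) d∣n

divisors-unique : ∀ n → Unique (divisors n)
divisors-unique n = Unique.filter⁺ (_∣? n) (Unique.map⁺ suc-injective (Unique.upTo⁺ n))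

codivisor : ℕ → ℕ → ℕ
codivisor n zero = 0
codivisor n (suc d) = n / suc d

codivisor-*ʳ : ∀ c d → .{{NonZero d}} → codivisor (c * d) d ≡ c
codivisor-*ʳ c (suc d) = m*n/n≡m c (suc d)

codivisor*d≤n : ∀ n d → codivisor n d * d ≤ n
codivisor*d≤n n zero = z≤n
codivisor*d≤n n (suc d) = m/n*n≤m n (suc d)

codivisor-∣ : ∀ {n d} → .{{NonZero n}} → d ∣ n → codivisor n d ∣ n
codivisor-∣ {d = d} (divides c refl) = subst (_∣ c * d) (sym (codivisor-*ʳ c d)) (m∣m*n d)
  where instance _ = m*n≢0⇒n≢0 c

codivisor-involutive : ∀ {n d} → .{{NonZero n}} → d ∣ n → codivisor n (codivisor n d) ≡ d
codivisor-involutive {d = d} (divides c refl) = begin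
  codivisor (c * d) (codivisor (c * d) d)  ≡⟨ cong (codivisor (c * d)) (codivisor-*ʳ c d) ⟩
  codivisor (c * d) c                      ≡⟨ cong (λ m → codivisor m c) (*-comm c d) ⟩
  codivisor (d * c) c                      ≡⟨ codivisor-*ʳ d c ⟩
  d                                        ∎
  where
  open ≡-Reasoning
  instance _ = m*n≢0⇒m≢0 c
  instance _ = m*n≢0⇒n≢0 c

Unique-map⁺ : ∀ {P : Pred ℕ 0ℓ} {f : ℕ → ℕ} → (∀ {x y} → P x → P y → f x ≡ f y → x ≡ y) →
              ∀ {xs} → All P xs → Unique xs → Unique (map f xs)
Unique-map⁺ inj [] AllPairs.[] = AllPairs.[]
Unique-map⁺ inj (px ∷ pxs) (x∉xs AllPairs.∷ u) =
  AllP.map⁺ (All.zipWith (λ (x≢y , py) fx≡fy → x≢y (inj px py fx≡fy)) (x∉xs , pxs))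
  AllPairs.∷ Unique-map⁺ inj pxs u

divisors-↭-codivisors : ∀ n → .{{NonZero n}} → divisors n ↭ map (codivisor n) (divisors n)
divisors-↭-codivisors n = ∼bag⇒↭ (unique∧set⇒bag (divisors-unique n)
  (Unique-map⁺ codivisor-injective (All.tabulate ∈-divisors⁻) (divisors-unique n))
  (mk⇔ to from))
  where
  codivisor-injective : ∀ {x y} → x ∣ n → y ∣ n → codivisor n x ≡ codivisor n y → x ≡ y
  codivisor-injective {x} {y} x∣n y∣n eq = begin
    x                            ≡⟨ codivisor-involutive x∣n ⟨
    codivisor n (codivisor n x)  ≡⟨ cong (codivisor n) eq ⟩
    codivisor n (codivisor n y)  ≡⟨ codivisor-involutive y∣n ⟩
    y                            ∎
    where open ≡-Reasoning
  to : ∀ {d} → d ∈ divisors n → d ∈ map (codivisor n) (divisors n)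
  to d∈ = subst (_∈ map (codivisor n) (divisors n)) (codivisor-involutive (∈-divisors⁻ d∈))
                (∈-map⁺ (codivisor n) (∈-divisors⁺ (codivisor-∣ (∈-divisors⁻ d∈))))
  from : ∀ {d} → d ∈ map (codivisor n) (divisors n) → d ∈ divisors n
  from d∈ with ∈-map⁻ (codivisor n) d∈
  ... | e , e∈ , refl = ∈-divisors⁺ (codivisor-∣ (∈-divisors⁻ e∈))

sumℤ-divisors-codivisor : ∀ n → .{{NonZero n}} → (f : ℕ → ℤ) →
                          sumℤ (map f (divisors n)) ≡ sumℤ (map (f ∘ codivisor n) (divisors n))
sumℤ-divisors-codivisor n f =
  trans (sumℤ-↭ (↭.map⁺ f (divisors-↭-codivisors n))) (cong sumℤ (sym (map-∘ (divisors n))))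

kron-1-mod4 : ∀ d → kron-1 d ≡ kron-1 (d % 4)
kron-1-mod4 d rewrite m%n%n≡m%n d 4 {{_}} with d % 4
... | 0 = refl
... | 1 = refl
... | 2 = refl
... | 3 = refl
... | suc (suc (suc (suc _))) = refl

kron-1-≡1 : ∀ n → n % 4 ≡ 1 → kron-1 n ≡ + 1
kron-1-≡1 n n%4≡1 rewrite n%4≡1 = refl

∣kron-1∣≤1 : ∀ d → ∣ kron-1 d ∣ ≤ 1
∣kron-1∣≤1 d with d % 4
... | 0 = z≤n
... | 1 = ≤-refl
... | 2 = z≤n
... | 3 = ≤-refl
... | suc (suc (suc (suc _))) = z≤n

kron-1-* : ∀ a b → kron-1 (a * b) ≡ kron-1 a ℤ.* kron-1 b
kron-1-* a b = begin
  kron-1 (a * b)                          ≡⟨ kron-1-mod4 (a * b) ⟩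
  kron-1 ((a * b) % 4)                    ≡⟨ cong kron-1 (%-distribˡ-* a b 4) ⟩
  kron-1 ((a % 4 * (b % 4)) % 4)          ≡⟨ kron-1-mod4 (a % 4 * (b % 4)) ⟨
  kron-1 (a % 4 * (b % 4))                ≡⟨ on-residues (m%n<n a 4) (m%n<n b 4) ⟩
  kron-1 (a % 4) ℤ.* kron-1 (b % 4)       ≡⟨ cong₂ ℤ._*_ (kron-1-mod4 a) (kron-1-mod4 b) ⟨
  kron-1 a ℤ.* kron-1 b                   ∎
  where
  open ≡-Reasoning
  on-residues : ∀ {r} → r < 4 → ∀ {s} → s < 4 → kron-1 (r * s) ≡ kron-1 r ℤ.* kron-1 s
  on-residues = from-yes (allUpTo? (λ r → allUpTo? (λ s → kron-1 (r * s) ℤP.≟ kron-1 r ℤ.* kron-1 s) 4) 4)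

∣kron-1∣-alternates : ∀ d → ∣ kron-1 d ∣ ≡ 0 ⊎ ∣ kron-1 (suc d) ∣ ≡ 0
∣kron-1∣-alternates d =
  subst₂ (λ x y → ∣ x ∣ ≡ 0 ⊎ ∣ y ∣ ≡ 0) (sym (kron-1-mod4 d)) (sym shift) (on-residues (m%n<n d 4))
  where
  on-residues : ∀ {r} → r < 4 → ∣ kron-1 r ∣ ≡ 0 ⊎ ∣ kron-1 (suc r) ∣ ≡ 0
  on-residues = from-yes (allUpTo? (λ r → (∣ kron-1 r ∣ ≟ 0) ⊎-dec (∣ kron-1 (suc r) ∣ ≟ 0)) 4)
  shift : kron-1 (suc d) ≡ kron-1 (suc (d % 4))
  shift = trans (kron-1-mod4 (suc d)) (trans (cong kron-1 (%-distribˡ-+ 1 d 4)) (sym (kron-1-mod4 (suc (d % 4)))))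

∣i∣≡1⇒i*i≡1 : ∀ i → ∣ i ∣ ≡ 1 → i ℤ.* i ≡ + 1
∣i∣≡1⇒i*i≡1 +[1+ 0 ] _ = refl
∣i∣≡1⇒i*i≡1 -[1+ 0 ] _ = refl

kron-1-codivisor : ∀ {n d} → ∣ kron-1 n ∣ ≡ 1 → d ∣ n → kron-1 (codivisor n d) ≡ kron-1 n ℤ.* kron-1 d
kron-1-codivisor {d = zero} ∣χn∣≡1 (divides c refl) rewrite *-zeroʳ c with () ← ∣χn∣≡1
kron-1-codivisor {d = suc d} ∣χn∣≡1 (divides c refl) = begin
  kron-1 (codivisor (c * suc d) (suc d))  ≡⟨ cong kron-1 (codivisor-*ʳ c (suc d)) ⟩
  χc                                      ≡⟨ ℤP.*-identityʳ χc ⟨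
  χc ℤ.* + 1                              ≡⟨ cong (χc ℤ.*_) (∣i∣≡1⇒i*i≡1 χd ∣χd∣≡1) ⟨
  χc ℤ.* (χd ℤ.* χd)                      ≡⟨ ℤP.*-assoc χc χd χd ⟨
  χc ℤ.* χd ℤ.* χd                        ≡⟨ cong (ℤ._* χd) (kron-1-* c (suc d)) ⟨
  kron-1 (c * suc d) ℤ.* χd               ∎
  where
  open ≡-Reasoning
  χc = kron-1 c
  χd = kron-1 (suc d)
  ∣χd∣≡1 : ∣ χd ∣ ≡ 1
  ∣χd∣≡1 = m*n≡1⇒n≡1 ∣ χc ∣ ∣ χd ∣
    (trans (sym (ℤP.∣i*j∣≡∣i∣*∣j∣ χc χd)) (trans (cong ∣_∣ (sym (kron-1-* c (suc d)))) ∣χn∣≡1))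

-- The dual sum Σ_{d ∣ n} (-1/d) (n/d)²

σχ′-term : ℕ → ℕ → ℤ
σχ′-term n d = kron-1 d ℤ.* + (codivisor n d * codivisor n d)

σχ′ : ℕ → ℤ
σχ′ n = sumℤ (map (σχ′-term n) (divisors n))

σχ≡kron-1*σχ′ : ∀ n → ∣ kron-1 n ∣ ≡ 1 → σχ n ≡ kron-1 n ℤ.* σχ′ n
σχ≡kron-1*σχ′ (suc m) ∣χn∣≡1 = begin
  sumℤ (map term (divisors n))                           ≡⟨ sumℤ-divisors-codivisor n term ⟩
  sumℤ (map (term ∘ codivisor n) (divisors n))           ≡⟨ sumℤ-map-cong (divisors n) (term-codivisor ∘ ∈-divisors⁻) ⟩
  sumℤ (map (λ d → χn ℤ.* σχ′-term n d) (divisors n))    ≡⟨ sumℤ-map-*ˡ χn (σχ′-term n) (divisors n) ⟩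
  χn ℤ.* σχ′ n                                           ∎
  where
  open ≡-Reasoning
  n = suc m
  χn = kron-1 n
  term : ℕ → ℤ
  term d = kron-1 d ℤ.* + d ℤ.* + d
  term-codivisor : ∀ {d} → d ∣ n → term (codivisor n d) ≡ χn ℤ.* σχ′-term n d
  term-codivisor {d} d∣n = let c = codivisor n d in begin
    kron-1 c ℤ.* + c ℤ.* + c                ≡⟨ cong (λ χc → χc ℤ.* + c ℤ.* + c) (kron-1-codivisor ∣χn∣≡1 d∣n) ⟩
    χn ℤ.* kron-1 d ℤ.* + c ℤ.* + c         ≡⟨ reassociate χn (kron-1 d) (+ c) ⟩
    χn ℤ.* (kron-1 d ℤ.* (+ c ℤ.* + c))     ≡⟨ cong (λ x → χn ℤ.* (kron-1 d ℤ.* x)) (ℤP.pos-* c c) ⟨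
    χn ℤ.* σχ′-term n d                     ∎
    where
    reassociate : ∀ a b x → a ℤ.* b ℤ.* x ℤ.* x ≡ a ℤ.* (b ℤ.* (x ℤ.* x))
    reassociate = ℤ-Solver.solve-∀

σχ≡σχ′ : ∀ n → kron-1 n ≡ + 1 → σχ n ≡ σχ′ n
σχ≡σχ′ n χn≡1 =
  trans (σχ≡kron-1*σχ′ n (cong ∣_∣ χn≡1)) (trans (cong (ℤ._* σχ′ n) χn≡1) (ℤP.*-identityˡ (σχ′ n)))

σχ≡-σχ′ : ∀ n → kron-1 n ≡ -[1+ 0 ] → σχ n ≡ ℤ.- σχ′ n
σχ≡-σχ′ n χn≡-1 =
  trans (σχ≡kron-1*σχ′ n (cong ∣_∣ χn≡-1)) (trans (cong (ℤ._* σχ′ n) χn≡-1) (ℤP.-1*i≡-i (σχ′ n)))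

σχ′-tail : ℕ → ℕ → ℕ → ℕ
σχ′-tail n a k = sum (map (λ d → ∣ σχ′-term n d ∣) (range a k))

∣σχ′-term∣ : ∀ n d → ∣ σχ′-term n d ∣ ≡ ∣ kron-1 d ∣ * (codivisor n d * codivisor n d)
∣σχ′-term∣ n d = ℤP.∣i*j∣≡∣i∣*∣j∣ (kron-1 d) _

d²*∣σχ′-term∣≤n² : ∀ n d → d * d * ∣ σχ′-term n d ∣ ≤ n * n
d²*∣σχ′-term∣≤n² n d = begin
  d * d * ∣ σχ′-term n d ∣               ≡⟨ cong (d * d *_) (∣σχ′-term∣ n d) ⟩
  d * d * (∣ kron-1 d ∣ * (c * c))       ≤⟨ *-monoʳ-≤ (d * d) (*-monoˡ-≤ (c * c) (∣kron-1∣≤1 d)) ⟩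
  d * d * (1 * (c * c))                  ≡⟨ square-product d c ⟩
  (c * d) * (c * d)                      ≤⟨ *-mono-≤ (codivisor*d≤n n d) (codivisor*d≤n n d) ⟩
  n * n                                  ∎
  where
  open ≤-Reasoning
  c = codivisor n d
  square-product : ∀ d c → d * d * (1 * (c * c)) ≡ (c * d) * (c * d)
  square-product = ℕ-Solver.solve-∀

-- Cleared of denominators, this is 1/a² ≤ 1/(2(a-1)) - 1/(2(a+1)) for a = 1 + b.
telescoping-step : ∀ b X Y N → (1 + b) * (1 + b) * X ≤ N → 2 * (2 + b) * Y ≤ N → 2 * b * (X + Y) ≤ N
telescoping-step b X Y N a²X≤N Y≤N = *-cancelˡ-≤ (2 + b) (begin
  (2 + b) * (2 * b * (X + Y))                    ≡⟨ expand b X Y ⟩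
  2 * b * (2 + b) * X + b * (2 * (2 + b) * Y)    ≤⟨ +-mono-≤ 2b[2+b]X≤2[1+b]²X (*-monoʳ-≤ b Y≤N) ⟩
  2 * ((1 + b) * (1 + b) * X) + b * N            ≤⟨ +-monoˡ-≤ (b * N) (*-monoʳ-≤ 2 a²X≤N) ⟩
  2 * N + b * N                                  ≡⟨ *-distribʳ-+ N 2 b ⟨
  (2 + b) * N                                    ∎)
  where
  open ≤-Reasoning
  expand : ∀ b X Y → (2 + b) * (2 * b * (X + Y)) ≡ 2 * b * (2 + b) * X + b * (2 * (2 + b) * Y)
  expand = ℕ-Solver.solve-∀
  complete-square : ∀ b X → (2 * b * (2 + b) + 2) * X ≡ 2 * ((1 + b) * (1 + b) * X)
  complete-square = ℕ-Solver.solve-∀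
  2b[2+b]X≤2[1+b]²X : 2 * b * (2 + b) * X ≤ 2 * ((1 + b) * (1 + b) * X)
  2b[2+b]X≤2[1+b]²X = ≤-trans (*-monoˡ-≤ X (m≤m+n (2 * b * (2 + b)) 2)) (≤-reflexive (complete-square b X))

σχ′-tail-skip : ∀ n a k → ∣ kron-1 a ∣ ≡ 0 → σχ′-tail n a (suc k) ≡ σχ′-tail n (suc a) k
σχ′-tail-skip n a k ∣χa∣≡0 =
  cong (_+ σχ′-tail n (suc a) k) (trans (∣σχ′-term∣ n a) (cong (_* (c * c)) ∣χa∣≡0))
  where c = codivisor n a

σχ′-tail-from-2 : ∀ n K → σχ′-tail n 2 (2 + K) ≡ codivisor n 3 * codivisor n 3 + σχ′-tail n 4 K
σχ′-tail-from-2 n K = cong (_+ σχ′-tail n 4 K) (trans (∣σχ′-term∣ n 3) (*-identityˡ _))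

σχ′-tail-bound : ∀ n b k → 2 * b * σχ′-tail n (suc b) k ≤ n * n
σχ′-tail-bound-vanishing : ∀ n a k → ∣ kron-1 a ∣ ≡ 0 → 2 * a * σχ′-tail n a k ≤ n * n

σχ′-tail-bound n b zero = subst (_≤ n * n) (sym (*-zeroʳ (2 * b))) z≤n
σχ′-tail-bound n b (suc k) with ∣kron-1∣-alternates (suc b)
... | inj₁ ∣χa∣≡0 = begin
  2 * b * σχ′-tail n (suc b) (suc k)      ≡⟨ cong (2 * b *_) (σχ′-tail-skip n (suc b) k ∣χa∣≡0) ⟩
  2 * b * σχ′-tail n (2 + b) k            ≤⟨ *-monoˡ-≤ _ (*-monoʳ-≤ 2 (n≤1+n b)) ⟩
  2 * (1 + b) * σχ′-tail n (2 + b) k      ≤⟨ σχ′-tail-bound n (suc b) k ⟩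
  n * n                                   ∎
  where open ≤-Reasoning
... | inj₂ ∣χa+1∣≡0 =
  telescoping-step b _ _ _ (d²*∣σχ′-term∣≤n² n (suc b)) (σχ′-tail-bound-vanishing n (2 + b) k ∣χa+1∣≡0)

σχ′-tail-bound-vanishing n a zero _ = subst (_≤ n * n) (sym (*-zeroʳ (2 * a))) z≤n
σχ′-tail-bound-vanishing n a (suc k) ∣χa∣≡0 =
  subst (λ t → 2 * a * t ≤ n * n) (sym (σχ′-tail-skip n a k ∣χa∣≡0)) (σχ′-tail-bound n a k)

σχ′-within : ℕ → List ℕ → ℤ
σχ′-within n xs = sumℤ (map (σχ′-term n) (filter (_∣? n) xs))

∣σχ′-within-range∣≤σχ′-tail : ∀ n a k → ∣ σχ′-within n (range a k) ∣ ≤ σχ′-tail n a k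
∣σχ′-within-range∣≤σχ′-tail n a k = ∣sumℤ-filter∣≤ (_∣? n) (σχ′-term n) (range a k)

σχ′-split : ∀ k → σχ′ (suc k) ≡ + (suc k * suc k) ℤ.+ σχ′-within (suc k) (range 2 k)
σχ′-split k = begin
  sumℤ (map (σχ′-term m) (divisors m))                 ≡⟨ cong (sumℤ ∘ map (σχ′-term m)) (divisors-suc k) ⟩
  σχ′-term m 1 ℤ.+ σχ′-within m (range 2 k)            ≡⟨ cong (ℤ._+ σχ′-within m (range 2 k)) leading ⟩
  + (m * m) ℤ.+ σχ′-within m (range 2 k)               ∎
  where
  open ≡-Reasoning
  m = suc k
  leading : σχ′-term m 1 ≡ + (m * m)
  leading = trans (ℤP.*-identityˡ _) (cong (λ c → + (c * c)) (n/1≡n m))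

σχ′-lower : ∀ k → + (suc k * suc k) ℤ.≤ σχ′ (suc k) ℤ.+ + σχ′-tail (suc k) 2 k
σχ′-lower k = begin
  + (m * m)                    ≡⟨ ℤP.+-identityʳ (+ (m * m)) ⟨
  + (m * m) ℤ.+ + 0            ≤⟨ ℤP.+-monoʳ-≤ (+ (m * m)) (∣i∣≤n⇒0≤i+n R (∣σχ′-within-range∣≤σχ′-tail m 2 k)) ⟩
  + (m * m) ℤ.+ (R ℤ.+ + T)    ≡⟨ ℤP.+-assoc (+ (m * m)) R (+ T) ⟨
  + (m * m) ℤ.+ R ℤ.+ + T      ≡⟨ cong (ℤ._+ + T) (σχ′-split k) ⟨
  σχ′ m ℤ.+ + T                ∎
  where
  open ℤP.≤-Reasoning
  m = suc k
  R = σχ′-within m (range 2 k)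
  T = σχ′-tail m 2 k

σχ′-upper : ∀ j → σχ′ (3 + j) ℤ.≤ + ((3 + j) * (3 + j) + σχ′-tail (3 + j) 4 j)
σχ′-upper j = begin
  σχ′ q                                           ≡⟨ σχ′-split (2 + j) ⟩
  + (q * q) ℤ.+ σχ′-within q (2 ∷ 3 ∷ range 4 j)  ≤⟨ ℤP.+-monoʳ-≤ (+ (q * q)) drop-2-and-3 ⟩
  + (q * q) ℤ.+ σχ′-within q (range 4 j)          ≤⟨ ℤP.+-monoʳ-≤ (+ (q * q)) within≤tail ⟩
  + (q * q) ℤ.+ + σχ′-tail q 4 j                  ≡⟨ ℤP.pos-+ (q * q) _ ⟨
  + (q * q + σχ′-tail q 4 j)                      ∎
  where
  open ℤP.≤-Reasoning
  q = 3 + j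
  term-3≤0 : σχ′-term q 3 ℤ.≤ + 0
  term-3≤0 = subst (ℤ._≤ + 0) (sym (ℤP.-1*i≡-i _)) (ℤP.neg-mono-≤ (ℤ.+≤+ z≤n))
  within≤tail : σχ′-within q (range 4 j) ℤ.≤ + σχ′-tail q 4 j
  within≤tail = ∣i∣≤n⇒i≤n (σχ′-within q (range 4 j)) (∣σχ′-within-range∣≤σχ′-tail q 4 j)
  drop-2-and-3 : σχ′-within q (2 ∷ 3 ∷ range 4 j) ℤ.≤ σχ′-within q (range 4 j)
  drop-2-and-3 = ℤP.≤-trans (sumℤ-filter-drop (_∣? q) (σχ′-term q) {2} (3 ∷ range 4 j) ℤP.≤-refl)
                            (sumℤ-filter-drop (_∣? q) (σχ′-term q) {3} (range 4 j) term-3≤0)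

σχ-positive : ∀ n → n % 4 ≡ 1 → + 0 ℤ.< σχ n
σχ-positive (suc k) n%4≡1 =
  subst (+ 0 ℤ.<_) (sym (σχ≡σχ′ n (kron-1-≡1 n n%4≡1)))
    (a≤i+b∧b<a⇒0<i (σχ′ n) (σχ′-lower k) (2*m≤n⇒m<n (σχ′-tail-bound n 1 k) z<s))
  where n = suc k

q²+E₁+6[q²+E₂]<[3q]² : ∀ q E₁ E₂ → .{{NonZero q}} → 8 * E₁ ≤ q * 3 * (q * 3) → 8 * E₂ ≤ q * q →
                        (q * q + E₁) + 6 * (q * q + E₂) < q * 3 * (q * 3)
q²+E₁+6[q²+E₂]<[3q]² q@(suc _) E₁ E₂ b₁ b₂ = *-cancelˡ-< 8 _ _ (begin-strict
  8 * ((Q + E₁) + 6 * (Q + E₂))          ≡⟨ expand Q E₁ E₂ ⟩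
  56 * Q + 8 * E₁ + 6 * (8 * E₂)         ≤⟨ +-mono-≤ (+-monoʳ-≤ (56 * Q) b₁) (*-monoʳ-≤ 6 b₂) ⟩
  56 * Q + q * 3 * (q * 3) + 6 * Q       ≡⟨ collect q ⟩
  71 * Q + 0                             <⟨ +-monoʳ-< (71 * Q) z<s ⟩
  71 * Q + Q                             ≡⟨ to-9Q q ⟩
  8 * (q * 3 * (q * 3))                  ∎)
  where
  open ≤-Reasoning
  Q = q * q
  expand : ∀ Q E₁ E₂ → 8 * ((Q + E₁) + 6 * (Q + E₂)) ≡ 56 * Q + 8 * E₁ + 6 * (8 * E₂)
  expand = ℕ-Solver.solve-∀
  collect : ∀ q → 56 * (q * q) + q * 3 * (q * 3) + 6 * (q * q) ≡ 71 * (q * q) + 0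
  collect = ℕ-Solver.solve-∀
  to-9Q : ∀ q → 71 * (q * q) + q * q ≡ 8 * (q * 3 * (q * 3))
  to-9Q = ℕ-Solver.solve-∀

0<x+6*y : ∀ (x y : ℤ) q E₁ E₂ → .{{NonZero q}} →
  + (q * 3 * (q * 3)) ℤ.≤ x ℤ.+ + (q * q + E₁) → 8 * E₁ ≤ q * 3 * (q * 3) →
  + 0 ℤ.≤ y ℤ.+ + (q * q + E₂) → 8 * E₂ ≤ q * q →
  + 0 ℤ.< x ℤ.+ + 6 ℤ.* y
0<x+6*y x y q E₁ E₂ h₁ b₁ h₂ b₂ =
  a≤i+b∧b<a⇒0<i (x ℤ.+ + 6 ℤ.* y) combined (q²+E₁+6[q²+E₂]<[3q]² q E₁ E₂ b₁ b₂)
  where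
  Q = q * q
  N = q * 3 * (q * 3)
  R₁ = Q + E₁
  R₂ = Q + E₂
  combined : + N ℤ.≤ (x ℤ.+ + 6 ℤ.* y) ℤ.+ + (R₁ + 6 * R₂)
  combined = begin
    + N                                            ≡⟨ ℤP.+-identityʳ (+ N) ⟨
    + N ℤ.+ + 6 ℤ.* + 0                            ≤⟨ ℤP.+-mono-≤ h₁ (ℤP.*-monoˡ-≤-nonNeg (+ 6) h₂) ⟩
    (x ℤ.+ + R₁) ℤ.+ + 6 ℤ.* (y ℤ.+ + R₂)          ≡⟨ regroup x y (+ R₁) (+ R₂) ⟩
    (x ℤ.+ + 6 ℤ.* y) ℤ.+ (+ R₁ ℤ.+ + 6 ℤ.* + R₂)  ≡⟨ cong (λ r → x ℤ.+ + 6 ℤ.* y ℤ.+ r) pos-R ⟨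
    (x ℤ.+ + 6 ℤ.* y) ℤ.+ + (R₁ + 6 * R₂)          ∎
    where
    open ℤP.≤-Reasoning
    regroup : ∀ x y r₁ r₂ →
              (x ℤ.+ r₁) ℤ.+ + 6 ℤ.* (y ℤ.+ r₂) ≡ (x ℤ.+ + 6 ℤ.* y) ℤ.+ (r₁ ℤ.+ + 6 ℤ.* r₂)
    regroup = ℤ-Solver.solve-∀
    pos-R : + (R₁ + 6 * R₂) ≡ + R₁ ℤ.+ + 6 ℤ.* + R₂
    pos-R = trans (ℤP.pos-+ R₁ (6 * R₂)) (cong (λ r → + R₁ ℤ.+ r) (ℤP.pos-* 6 R₂))

σχ+6σχ[n/3]-positive : ∀ n → n % 4 ≡ 1 → 3 ∣ n → + 0 ℤ.< σχ n ℤ.+ + 6 ℤ.* σχ (n / 3)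
-- q ≤ 2 is impossible, as then n % 4 ≢ 1.
σχ+6σχ[n/3]-positive .(q * 3) n%4≡1 (divides q@(suc (suc (suc j))) refl) =
  subst (λ m → + 0 ℤ.< σχ n ℤ.+ + 6 ℤ.* σχ m) (sym (m*n/n≡m q 3))
    (0<x+6*y (σχ n) (σχ q) q E₁ E₂ lower-n tail-n lower-q tail-q)
  where
  n = q * 3
  K = (2 + j) * 3
  E₁ = σχ′-tail n 4 K
  E₂ = σχ′-tail q 4 j
  χn≡1 : kron-1 n ≡ + 1
  χn≡1 = kron-1-≡1 n n%4≡1
  χq≡-1 : kron-1 q ≡ -[1+ 0 ]
  χq≡-1 = begin
    kron-1 q                          ≡⟨ ℤP.*-identityʳ (kron-1 q) ⟨
    kron-1 q ℤ.* (χ3 ℤ.* χ3)          ≡⟨ ℤP.*-assoc (kron-1 q) χ3 χ3 ⟨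
    kron-1 q ℤ.* χ3 ℤ.* χ3            ≡⟨ cong (ℤ._* χ3) (kron-1-* q 3) ⟨
    kron-1 n ℤ.* χ3                   ≡⟨ cong (ℤ._* χ3) χn≡1 ⟩
    -[1+ 0 ]                          ∎
    where
    open ≡-Reasoning
    χ3 = kron-1 3
  lower-n : + (n * n) ℤ.≤ σχ n ℤ.+ + (q * q + E₁)
  lower-n = subst₂ (λ s t → + (n * n) ℤ.≤ s ℤ.+ + t) (sym (σχ≡σχ′ n χn≡1))
    (trans (σχ′-tail-from-2 n K) (cong (λ c → c * c + E₁) (codivisor-*ʳ q 3)))
    (σχ′-lower (2 + K))
  tail-n : 8 * E₁ ≤ n * n
  tail-n = σχ′-tail-bound-vanishing n 4 K refl
  lower-q : + 0 ℤ.≤ σχ q ℤ.+ + (q * q + E₂)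
  lower-q = subst (λ s → + 0 ℤ.≤ s ℤ.+ + (q * q + E₂)) (sym (σχ≡-σχ′ q χq≡-1))
    (subst (+ 0 ℤ.≤_) (ℤP.+-comm (+ (q * q + E₂)) (ℤ.- σχ′ q)) (ℤP.i≤j⇒0≤j-i (σχ′-upper j)))
  tail-q : 8 * E₂ ≤ q * q
  tail-q = σχ′-tail-bound-vanishing q 4 j refl

B-positive : ∀ n → n % 4 ≡ 1 → + 0 ℤ.< B n
B-positive n n%4≡1 with 3 ∣? n
... | yes 3∣n = σχ+6σχ[n/3]-positive n n%4≡1 3∣n
... | no _    = subst (+ 0 ℤ.<_) (sym (ℤP.+-identityʳ (σχ n))) (σχ-positive n n%4≡1)

-- Signs of the coefficients A(4k + 1)

sgn-positive : ∀ p → ℚ.Positive p → sgn p ≡ + 1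
sgn-positive (mkℚ +[1+ _ ] _ _) _ = refl

sgn-negative : ∀ p → ℚ.Negative p → sgn p ≡ -[1+ 0 ]
sgn-negative (mkℚ -[1+ _ ] _ _) _ = refl

toℚ-positive : ∀ {z} → + 0 ℤ.< z → ℚ.Positive (toℚ z)
toℚ-positive {+[1+ m ]} _ = ℚP.normalize-pos (suc m) 1
toℚ-positive {+ 0} (ℤ.+<+ ())

%12⇒%4 : ∀ N {r} → N % 12 ≡ r → N % 4 ≡ r % 4
%12⇒%4 N N%12≡r = trans (sym (m∣n⇒o%n%m≡o%m 4 12 N (divides 3 refl))) (cong (_% 4) N%12≡r)

sgn-A-1 : ∀ N → N % 12 ≡ 1 → sgn (A N) ≡ + 1
sgn-A-1 N N%12≡1 rewrite N%12≡1 =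
  sgn-positive (toℚ (σχ N)) (toℚ-positive (σχ-positive N (%12⇒%4 N N%12≡1)))

sgn-A-5 : ∀ N → N % 12 ≡ 5 → sgn (A N) ≡ -[1+ 0 ]
sgn-A-5 N N%12≡5 rewrite N%12≡5 =
  sgn-negative (ℚ.- (ℚ.½ ℚ.* σχN)) (ℚP.neg-pos {ℚ.½ ℚ.* σχN} (ℚP.pos*pos⇒pos ℚ.½ σχN {{σχN>0}}))
  where
  σχN = toℚ (σχ N)
  σχN>0 = toℚ-positive (σχ-positive N (%12⇒%4 N N%12≡5))

sgn-A-9 : ∀ N → N % 12 ≡ 9 → sgn (A N) ≡ -[1+ 0 ]
sgn-A-9 N N%12≡9 rewrite N%12≡9 =
  sgn-negative (ℚ.- (toℚ (+ 2) ℚ.* BN))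
    (ℚP.neg-pos {toℚ (+ 2) ℚ.* BN} (ℚP.pos*pos⇒pos (toℚ (+ 2)) {{toℚ-positive {+ 2} (ℤ.+<+ z<s)}} BN {{BN>0}}))
  where
  BN = toℚ (σχ N ℤ.+ + 6 ℤ.* σχ (N / 3))
  3∣N = m%n≡0⇒n∣m N 3 (trans (sym (m∣n⇒o%n%m≡o%m 3 12 N (divides 4 refl))) (cong (_% 3) N%12≡9))
  BN>0 = toℚ-positive (σχ+6σχ[n/3]-positive N (%12⇒%4 N N%12≡9) 3∣N)

[4k+1]%12 : ∀ k → (4 * k + 1) % 12 ≡ (1 + 4 * (k % 3)) % 12
[4k+1]%12 k = trans (cong (_% 12) decomposition) ([m+kn]%n≡m%n (1 + 4 * (k % 3)) (k / 3) 12)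
  where
  regroup : ∀ r s → 4 * (r + s * 3) + 1 ≡ (1 + 4 * r) + s * 12
  regroup = ℕ-Solver.solve-∀
  decomposition : 4 * k + 1 ≡ (1 + 4 * (k % 3)) + k / 3 * 12
  decomposition = trans (cong (λ m → 4 * m + 1) (m≡m%n+[m/n]*n k 3)) (regroup (k % 3) (k / 3))

sgn-A-4k+1 : ∀ k → (3 ∣ k → sgn (A (4 * k + 1)) ≡ + 1) × (¬ (3 ∣ k) → sgn (A (4 * k + 1)) ≡ -[1+ 0 ])
sgn-A-4k+1 k = by-residue (k % 3) refl (m%n<n k 3)
  where
  residue : ∀ {r} → k % 3 ≡ r → (4 * k + 1) % 12 ≡ (1 + 4 * r) % 12
  residue k%3≡r = trans ([4k+1]%12 k) (cong (λ r → (1 + 4 * r) % 12) k%3≡r)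
  3∣k⇒k%3≡0 : 3 ∣ k → k % 3 ≡ 0
  3∣k⇒k%3≡0 = n∣m⇒m%n≡0 k 3
  by-residue : ∀ r → k % 3 ≡ r → r < 3 →
               (3 ∣ k → sgn (A (4 * k + 1)) ≡ + 1) × (¬ (3 ∣ k) → sgn (A (4 * k + 1)) ≡ -[1+ 0 ])
  by-residue 0 k%3≡0 _ = (λ _ → sgn-A-1 (4 * k + 1) (residue k%3≡0))
                       , (λ 3∤k → contradiction (m%n≡0⇒n∣m k 3 k%3≡0) 3∤k)
  by-residue 1 k%3≡1 _ = (λ 3∣k → contradiction (trans (sym k%3≡1) (3∣k⇒k%3≡0 3∣k)) λ ())
                       , (λ _ → sgn-A-5 (4 * k + 1) (residue k%3≡1))
  by-residue 2 k%3≡2 _ = (λ 3∣k → contradiction (trans (sym k%3≡2) (3∣k⇒k%3≡0 3∣k)) λ ())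
                       , (λ _ → sgn-A-9 (4 * k + 1) (residue k%3≡2))
  by-residue (suc (suc (suc _))) _ (s≤s (s≤s (s≤s ())))

lemma5p2 : ((n : ℕ) → n ≥ 1 → n % 4 ≡ 1 → B n ℤ.> + 0)
    × ((n : ℕ) → (3 ∣ n → sgn (A (4 * n + 1)) ≡ + 1)
    × (¬ (3 ∣ n) → sgn (A (4 * n + 1)) ≡ -[1+ 0 ]))
-- The hypothesis n ≥ 1 is implied by n % 4 ≡ 1.
lemma5p2 = (λ n _ → B-positive n) , sgn-A-4k+1
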